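{- Let $p$ be an odd prime and $l$ an integer with $1\le l\le p-1$. Then $N_1\big(\tfrac{l}{p}\rho_\Delta+A_{p-1}^*\big)\ge\frac{(p-1)(p+1)}{12p}$, i.e. every vector $x\in\frac lp\rho_\Delta+A_{p-1}^*$ satisfies $(x,x)\ge\frac{(p-1)(p+1)}{12p}$.
   Context: $A_{p-1}=\{x\in\mathbb{Z}^p:\sum x_i=0\}$ with the standard inner product of $\mathbb{R}^p$, and $A_{p-1}^*$ its dual lattice (inside $\{x\in\mathbb{R}^p:\sum x_i=0\}$). $\rho_\Delta=\frac12\sum_{1\le i<j\le p}(e_i-e_j)$, half the sum of the positive roots with respect to the base $\{e_i-e_{i+1}\}$. For a subset $S$, $N_1(S)$ is the minimal squared norm of nonzero elements of $S$. -}

module Defs where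

open import Data.Nat using (ℕ; zero; suc)
open import Data.Integer using (ℤ; +_)
open import Data.Fin using (Fin)
open import Data.Fin.Properties using (_≟_; _<?_)
open import Data.Rational using (ℚ; 0ℚ; 1ℚ; ½; _+_; _*_; _-_; _/_)
open import Data.Bool using (if_then_else_)
open import Relation.Nullary.Decidable using (does)
open import Relation.Binary.PropositionalEquality using (_≡_)
open import Data.Product using (∃; _×_)

Vecℚ : ℕ → Set
Vecℚ p = Fin p → ℚ

sumℚ : (n : ℕ) → (Fin n → ℚ) → ℚ
sumℚ zero    f = 0ℚ
sumℚ (suc n) f = f Fin.zero + sumℚ n (λ i → f (Fin.suc i))

-- integer n / d as a rational (d = 0 never used; returns 0 then)
frac : ℤ → ℕ → ℚ
frac n zero    = 0ℚ
frac n (suc d) = n / suc d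

ι : ℤ → ℚ
ι n = n / 1

⟪_,_⟫ : {p : ℕ} → Vecℚ p → Vecℚ p → ℚ
⟪_,_⟫ {p} x y = sumℚ p (λ i → x i * y i)

e : {p : ℕ} → Fin p → Vecℚ p
e i k = if does (i ≟ k) then 1ℚ else 0ℚ

A : (p : ℕ) → (Fin p → ℤ) → Set
A p x = sumℚ p (λ i → ι (x i)) ≡ 0ℚ

Adual : (p : ℕ) → Vecℚ p → Set
Adual p v = (sumℚ p v ≡ 0ℚ)
  × ((w : Fin p → ℤ) → A p w → ∃ λ (k : ℤ) → ⟪ v , (λ i → ι (w i)) ⟫ ≡ ι k)

ρΔ : (p : ℕ) → Vecℚ p
ρΔ p k = ½ * sumℚ p (λ i → sumℚ p (λ j →
  if does (i <? j) then (e i k - e j k) else 0ℚ))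

_·_ : {p : ℕ} → ℚ → Vecℚ p → Vecℚ p
(c · x) i = c * x i

_⊕_ : {p : ℕ} → Vecℚ p → Vecℚ p → Vecℚ p
(x ⊕ y) i = x i + y i

-- The coordinates of ρ_Δ are (p-1)/2 - k and those of a vector of A*_{p-1} differ by
-- integers, so a vector x of (l/p) ρ_Δ + A*_{p-1} has p x_k = c + a_k with
-- a_k = p m_k - l k.  As p is prime and 0 < l < p, the integers a_k are pairwise distinct.
-- Completing the square, p³ (x, x) = p Σ (c + a_k)² ≥ p Σ a_k² - (Σ a_k)², and for p
-- distinct integers this dispersion is at least p²(p²-1)/12, its value at 0, …, p-1
-- (remove the largest value and induct).
module Submission where

open import Defs
open import Algebra.Bundles using (AbelianGroup; CommutativeRing)
open import Data.Bool using (Bool; true; false; if_then_else_)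
open import Data.Fin using (Fin; zero; suc; toℕ; punchIn)
open import Data.Fin.Properties using (_≟_; _<?_; toℕ≤pred[n]; toℕ-injective; punchIn-injective; punchInᵢ≢i)
open import Data.Integer as ℤ using (ℤ; +_; 0ℤ; ∣_∣)
import Data.Integer.Properties as ℤP
open import Data.Integer.Tactic.RingSolver using () renaming (ring to ℤ-ring)
open import Data.List using (allFin)
open import Data.List.Extrema ℤP.≤-totalOrder using (argmax; f[xs]≤f[argmax])
open import Data.List.Membership.Propositional.Properties using (∈-allFin)
open import Data.List.Relation.Unary.All using (lookup)
open import Data.Nat as ℕ using (ℕ; zero; suc; NonZero; s≤s; _∸_)
import Data.Nat.Properties as ℕP
open import Data.Nat.Divisibility using (_∣_; divides; >⇒∤)
open import Data.Nat.Primality using (Prime; euclidsLemma; ¬prime[0])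
open import Data.Product using (∃-syntax; _,_; proj₁; proj₂; map₂)
open import Data.Rational as ℚ using (ℚ; 0ℚ; 1ℚ; ½; toℚᵘ)
import Data.Rational.Properties as ℚP
open import Data.Rational.Unnormalised as ℚᵘ using (mkℚᵘ; *≡*; *≤*) renaming (_≃_ to _≃ᵘ_)
import Data.Rational.Unnormalised.Properties as ℚᵘP
open import Data.Sum using (inj₁; inj₂)
open import Data.Vec.Functional using (removeAt)
open import Function using (_∘_)
open import Function.Definitions using (Injective)
open import Level using (0ℓ)
open import Relation.Binary.PropositionalEquality
open import Relation.Nullary using (contradiction)
open import Relation.Nullary.Decidable using (does; dec⇒maybe)
open import Tactic.RingSolver using (solve-∀)
open import Tactic.RingSolver.Core.AlmostCommutativeRing using (AlmostCommutativeRing; fromCommutativeRing)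
open import Algebra.Properties.Semiring.Sum ℤP.+-*-semiring
  using () renaming (sum to ∑ℤ; sum-remove to ∑ℤ-remove)
open import Algebra.Properties.Semiring.Sum (CommutativeRing.semiring ℚP.+-*-commutativeRing)
  using (sum-syntax; sum-cong-≗; *-distribˡ-sum; sum-replicate-zero)

module Dispersion where

  open import Data.Integer using (_+_; _-_; -_; _*_; _≤_; _<_)
  open import Algebra.Properties.Group (AbelianGroup.group ℤP.+-0-abelianGroup) using (∙-cancelˡ)

  -- n² times the variance of the values of f.
  dispersion : ∀ {n} → (Fin n → ℤ) → ℤ
  dispersion {n} f = + n * ∑ℤ (λ j → f j * f j) - ∑ℤ f * ∑ℤ f

  module _ {n} (f : Fin (suc n) → ℤ) where

    maxIndex : Fin (suc n)
    maxIndex = argmax f zero (allFin (suc n))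

    f≤f[maxIndex] : ∀ j → f j ≤ f maxIndex
    f≤f[maxIndex] j = lookup (f[xs]≤f[argmax] {f = f} zero (allFin (suc n))) (∈-allFin j)

    removeAt-maxIndex< : Injective _≡_ _≡_ f → ∀ j → removeAt f maxIndex j < f maxIndex
    removeAt-maxIndex< f-inj j =
      ℤP.≤∧≢⇒< (f≤f[maxIndex] (punchIn maxIndex j)) (punchInᵢ≢i maxIndex j ∘ f-inj)

  removeAt-injective : ∀ {n} {f : Fin (suc n) → ℤ} i → Injective _≡_ _≡_ f → Injective _≡_ _≡_ (removeAt f i)
  removeAt-injective i f-inj = punchIn-injective i _ _ ∘ f-inj

  i<j⇒0<j-i : ∀ {i j} → i < j → 0ℤ < j - i
  i<j⇒0<j-i {i} {j} i<j = subst (_< j - i) (ℤP.+-inverseʳ i) (ℤP.+-monoˡ-< (- i) i<j)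

  square-mono-≤ : ∀ {m j} → + m ≤ j → + m * + m ≤ j * j
  square-mono-≤ {m} {+ k} m≤k =
    ℤP.≤-trans (ℤP.*-monoˡ-≤-nonNeg (+ m) m≤k) (ℤP.*-monoʳ-≤-nonNeg (+ k) m≤k)

  injective-positive⇒1+n≤max : ∀ {n} (d : Fin (suc n) → ℤ) → Injective _≡_ _≡_ d → (∀ j → 0ℤ < d j) →
    + suc n ≤ d (maxIndex d)
  injective-positive⇒1+n≤max {zero}  d _     d>0 = ℤP.i<j⇒suc[i]≤j (d>0 (maxIndex d))
  injective-positive⇒1+n≤max {suc n} d d-inj d>0 = ℤP.i<j⇒suc[i]≤j (ℤP.≤-<-trans
    (injective-positive⇒1+n≤max (removeAt d M) (removeAt-injective M d-inj) (d>0 ∘ punchIn M))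
    (removeAt-maxIndex< d d-inj (maxIndex (removeAt d M))))
    where M = maxIndex d

  injective-positive⇒∑-square-bound : ∀ {n} (d : Fin n → ℤ) → Injective _≡_ _≡_ d → (∀ j → 0ℤ < d j) →
    + n * (+ n + + 1) * (+ 2 * + n + + 1) ≤ + 6 * ∑ℤ (λ j → d j * d j)
  injective-positive⇒∑-square-bound {zero}  d _     _   = ℤP.≤-refl
  injective-positive⇒∑-square-bound {suc n} d d-inj d>0 = begin
    + suc n * (+ suc n + + 1) * (+ 2 * + suc n + + 1)
      ≡⟨ split (+ n) ⟩
    + 6 * (+ suc n * + suc n) + + n * (+ n + + 1) * (+ 2 * + n + + 1)
      ≤⟨ ℤP.+-mono-≤ (ℤP.*-monoˡ-≤-nonNeg (+ 6) (square-mono-≤ (injective-positive⇒1+n≤max d d-inj d>0)))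
                     (injective-positive⇒∑-square-bound (removeAt d M) (removeAt-injective M d-inj) (d>0 ∘ punchIn M)) ⟩
    + 6 * (d M * d M) + + 6 * ∑ℤ (λ j → removeAt d M j * removeAt d M j)
      ≡⟨ ℤP.*-distribˡ-+ (+ 6) (d M * d M) _ ⟨
    + 6 * (d M * d M + ∑ℤ (λ j → removeAt d M j * removeAt d M j))
      ≡⟨ cong (+ 6 *_) (∑ℤ-remove {i = M} (λ j → d j * d j)) ⟨
    + 6 * ∑ℤ (λ j → d j * d j) ∎
    where
    open ℤP.≤-Reasoning
    M = maxIndex d
    split : ∀ n → (+ 1 + n) * (+ 1 + n + + 1) * (+ 2 * (+ 1 + n) + + 1)
                ≡ + 6 * ((+ 1 + n) * (+ 1 + n)) + n * (n + + 1) * (+ 2 * n + + 1)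
    split = solve-∀ ℤ-ring

  ∑-square-sub : ∀ {n} a (g : Fin n → ℤ) →
    ∑ℤ (λ j → (a - g j) * (a - g j)) ≡ + n * a * a - (a + a) * ∑ℤ g + ∑ℤ (λ j → g j * g j)
  ∑-square-sub {zero}  a g = vanish a
    where
    vanish : ∀ a → + 0 ≡ + 0 * a * a - (a + a) * + 0 + + 0
    vanish = solve-∀ ℤ-ring
  ∑-square-sub {suc n} a g = begin
    (a - g zero) * (a - g zero) + ∑ℤ (λ j → (a - g (suc j)) * (a - g (suc j)))
      ≡⟨ cong (λ s → (a - g zero) * (a - g zero) + s) (∑-square-sub a (g ∘ suc)) ⟩
    (a - g zero) * (a - g zero) + (+ n * a * a - (a + a) * ∑ℤ (g ∘ suc) + ∑ℤ (λ j → g (suc j) * g (suc j)))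
      ≡⟨ expand (+ n) a (g zero) _ _ ⟩
    + suc n * a * a - (a + a) * ∑ℤ g + ∑ℤ (λ j → g j * g j) ∎
    where
    open ≡-Reasoning
    expand : ∀ n a b s t → (a - b) * (a - b) + (n * a * a - (a + a) * s + t)
                         ≡ (+ 1 + n) * a * a - (a + a) * (b + s) + (b * b + t)
    expand = solve-∀ ℤ-ring

  dispersion-removeAt : ∀ {n} (f : Fin (suc n) → ℤ) i →
    dispersion f ≡ dispersion (removeAt f i) + ∑ℤ (λ j → (f i - removeAt f i j) * (f i - removeAt f i j))
  dispersion-removeAt {n} f i = begin
    + suc n * ∑ℤ (λ j → f j * f j) - ∑ℤ f * ∑ℤ f
      ≡⟨ cong₂ (λ s t → + suc n * s - t * t) (∑ℤ-remove {i = i} (λ j → f j * f j)) (∑ℤ-remove {i = i} f) ⟩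
    + suc n * (f i * f i + ∑ℤ (λ j → g j * g j)) - (f i + ∑ℤ g) * (f i + ∑ℤ g)
      ≡⟨ regroup (+ n) (f i) (∑ℤ g) (∑ℤ (λ j → g j * g j)) ⟩
    dispersion g + (+ n * f i * f i - (f i + f i) * ∑ℤ g + ∑ℤ (λ j → g j * g j))
      ≡⟨ cong (λ s → dispersion g + s) (∑-square-sub (f i) g) ⟨
    dispersion g + ∑ℤ (λ j → (f i - g j) * (f i - g j)) ∎
    where
    open ≡-Reasoning
    g = removeAt f i
    regroup : ∀ n a s t → (+ 1 + n) * (a * a + t) - (a + s) * (a + s)
                        ≡ (n * t - s * s) + (n * a * a - (a + a) * s + t)
    regroup = solve-∀ ℤ-ring

  injective⇒dispersion-bound : ∀ {n} (f : Fin n → ℤ) → Injective _≡_ _≡_ f →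
    + n * + n * (+ n * + n - + 1) ≤ + 12 * dispersion f
  injective⇒dispersion-bound {zero}  f _     = ℤP.≤-refl
  injective⇒dispersion-bound {suc n} f f-inj = begin
    + suc n * + suc n * (+ suc n * + suc n - + 1)
      ≡⟨ split (+ n) ⟩
    + n * + n * (+ n * + n - + 1) + + 2 * (+ n * (+ n + + 1) * (+ 2 * + n + + 1))
      ≤⟨ ℤP.+-mono-≤ (injective⇒dispersion-bound g (removeAt-injective M f-inj))
                     (ℤP.*-monoˡ-≤-nonNeg (+ 2) (injective-positive⇒∑-square-bound gap gap-inj gap>0)) ⟩
    + 12 * dispersion g + + 2 * (+ 6 * ∑ℤ (λ j → gap j * gap j))
      ≡⟨ collect (dispersion g) (∑ℤ (λ j → gap j * gap j)) ⟩
    + 12 * (dispersion g + ∑ℤ (λ j → gap j * gap j))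
      ≡⟨ cong (+ 12 *_) (dispersion-removeAt f M) ⟨
    + 12 * dispersion f ∎
    where
    open ℤP.≤-Reasoning
    M = maxIndex f
    g = removeAt f M
    gap : Fin n → ℤ
    gap j = f M - g j
    gap-inj : Injective _≡_ _≡_ gap
    gap-inj = removeAt-injective M f-inj ∘ ℤP.neg-injective ∘ ∙-cancelˡ (f M) _ _
    gap>0 : ∀ j → 0ℤ < gap j
    gap>0 j = i<j⇒0<j-i (removeAt-maxIndex< f f-inj j)
    split : ∀ n → (+ 1 + n) * (+ 1 + n) * ((+ 1 + n) * (+ 1 + n) - + 1)
                ≡ n * n * (n * n - + 1) + + 2 * (n * (n + + 1) * (+ 2 * n + + 1))
    split = solve-∀ ℤ-ring
    collect : ∀ a b → + 12 * a + + 2 * (+ 6 * b) ≡ + 12 * (a + b)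
    collect = solve-∀ ℤ-ring

module AffineInjectivity where

  open import Data.Integer using (_+_; _-_; _*_)

  prime∣*⇒≡0 : ∀ {p l d} → Prime p → .{{NonZero l}} → l ℕ.< p → d ℕ.< p → p ∣ l ℕ.* d → d ≡ 0
  prime∣*⇒≡0 {d = zero}              _  _   _   _    = refl
  prime∣*⇒≡0 {l = l} {d = d@(suc _)} pr l<p d<p p∣ld with euclidsLemma l d pr p∣ld
  ... | inj₁ p∣l = contradiction p∣l (>⇒∤ l<p)
  ... | inj₂ p∣d = contradiction p∣d (>⇒∤ d<p)

  ∣i-j∣≤n : ∀ {n} (i j : Fin (suc n)) → ∣ + toℕ i - + toℕ j ∣ ℕ.≤ n
  ∣i-j∣≤n i j = subst (ℕ._≤ _) (cong ∣_∣ (sym (ℤP.m-n≡m⊖n (toℕ i) (toℕ j))))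
    (ℕP.≤-trans (ℤP.∣m⊝n∣≤m⊔n (toℕ i) (toℕ j)) (ℕP.⊔-lub (toℕ≤pred[n] i) (toℕ≤pred[n] j)))

  affine-injective : ∀ {n l} → Prime (suc n) → .{{NonZero l}} → l ℕ.≤ n → (m : Fin (suc n) → ℤ) →
    Injective _≡_ _≡_ (λ k → + suc n * m k - + l * + toℕ k)
  affine-injective {n} {l} pr l≤n m {i} {j} eq =
    toℕ-injective (ℤP.+-injective (ℤP.i-j≡0⇒i≡j _ _ (ℤP.∣i∣≡0⇒i≡0
      (prime∣*⇒≡0 pr (s≤s l≤n) (s≤s (∣i-j∣≤n i j)) (divides ∣ m i - m j ∣ l*∣i-j∣≡∣m-m∣*p)))))
    where
    p = suc n
    p*[m-m]≡l*[i-j] : + p * (m i - m j) ≡ + l * (+ toℕ i - + toℕ j)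
    p*[m-m]≡l*[i-j] = begin
      + p * (m i - m j)
        ≡⟨ shift (+ p) (m i) (m j) (+ l) (+ toℕ i) (+ toℕ j) ⟩
      (+ p * m i - + l * + toℕ i) - (+ p * m j - + l * + toℕ j) + + l * (+ toℕ i - + toℕ j)
        ≡⟨ cong (λ t → t - (+ p * m j - + l * + toℕ j) + + l * (+ toℕ i - + toℕ j)) eq ⟩
      (+ p * m j - + l * + toℕ j) - (+ p * m j - + l * + toℕ j) + + l * (+ toℕ i - + toℕ j)
        ≡⟨ cancel (+ p * m j - + l * + toℕ j) (+ l * (+ toℕ i - + toℕ j)) ⟩
      + l * (+ toℕ i - + toℕ j) ∎
      where
      open ≡-Reasoning
      shift : ∀ P a b L x y → P * (a - b) ≡ (P * a - L * x) - (P * b - L * y) + L * (x - y)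
      shift = solve-∀ ℤ-ring
      cancel : ∀ u w → u - u + w ≡ w
      cancel = solve-∀ ℤ-ring
    l*∣i-j∣≡∣m-m∣*p : l ℕ.* ∣ + toℕ i - + toℕ j ∣ ≡ ∣ m i - m j ∣ ℕ.* p
    l*∣i-j∣≡∣m-m∣*p = begin
      l ℕ.* ∣ + toℕ i - + toℕ j ∣   ≡⟨ ℤP.abs-* (+ l) (+ toℕ i - + toℕ j) ⟨
      ∣ + l * (+ toℕ i - + toℕ j) ∣  ≡⟨ cong ∣_∣ p*[m-m]≡l*[i-j] ⟨
      ∣ + p * (m i - m j) ∣          ≡⟨ ℤP.abs-* (+ p) (m i - m j) ⟩
      p ℕ.* ∣ m i - m j ∣            ≡⟨ ℕP.*-comm p _ ⟩
      ∣ m i - m j ∣ ℕ.* p            ∎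
      where open ≡-Reasoning

ℚ-ring : AlmostCommutativeRing 0ℓ 0ℓ
ℚ-ring = fromCommutativeRing ℚP.+-*-commutativeRing (λ x → dec⇒maybe (0ℚ ℚP.≟ x))

module Embedding where

  open import Data.Rational using (_+_; _-_; -_; _*_; _≤_)

  toℚᵘ-ι : ∀ a → toℚᵘ (ι a) ≃ᵘ mkℚᵘ a 0
  toℚᵘ-ι a = ℚP.toℚᵘ-fromℚᵘ (mkℚᵘ a 0)

  ι-+ : ∀ a b → ι (a ℤ.+ b) ≡ ι a + ι b
  ι-+ a b = ℚP.toℚᵘ-injective (begin
    toℚᵘ (ι (a ℤ.+ b))             ≈⟨ toℚᵘ-ι (a ℤ.+ b) ⟩
    mkℚᵘ (a ℤ.+ b) 0               ≈⟨ *≡* (cross-multiplied a b) ⟩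
    mkℚᵘ a 0 ℚᵘ.+ mkℚᵘ b 0         ≈⟨ ℚᵘP.+-cong (toℚᵘ-ι a) (toℚᵘ-ι b) ⟨
    toℚᵘ (ι a) ℚᵘ.+ toℚᵘ (ι b)     ≈⟨ ℚP.toℚᵘ-homo-+ (ι a) (ι b) ⟨
    toℚᵘ (ι a + ι b)               ∎)
    where
    open ℚᵘP.≃-Reasoning
    cross-multiplied : ∀ a b → (a ℤ.+ b) ℤ.* + 1 ≡ (a ℤ.* + 1 ℤ.+ b ℤ.* + 1) ℤ.* + 1
    cross-multiplied = solve-∀ ℤ-ring

  ι-* : ∀ a b → ι (a ℤ.* b) ≡ ι a * ι b
  ι-* a b = ℚP.toℚᵘ-injective (begin
    toℚᵘ (ι (a ℤ.* b))             ≈⟨ toℚᵘ-ι (a ℤ.* b) ⟩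
    mkℚᵘ a 0 ℚᵘ.* mkℚᵘ b 0         ≈⟨ ℚᵘP.*-cong (toℚᵘ-ι a) (toℚᵘ-ι b) ⟨
    toℚᵘ (ι a) ℚᵘ.* toℚᵘ (ι b)     ≈⟨ ℚP.toℚᵘ-homo-* (ι a) (ι b) ⟨
    toℚᵘ (ι a * ι b)               ∎)
    where open ℚᵘP.≃-Reasoning

  ι-neg : ∀ a → ι (ℤ.- a) ≡ - ι a
  ι-neg a = ℚP.toℚᵘ-injective (begin
    toℚᵘ (ι (ℤ.- a))               ≈⟨ toℚᵘ-ι (ℤ.- a) ⟩
    ℚᵘ.- mkℚᵘ a 0                  ≈⟨ ℚᵘP.-‿cong (toℚᵘ-ι a) ⟨
    ℚᵘ.- toℚᵘ (ι a)                ≈⟨ ℚP.toℚᵘ-homo‿- (ι a) ⟨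
    toℚᵘ (- ι a)                   ∎)
    where open ℚᵘP.≃-Reasoning

  ι-- : ∀ a b → ι (a ℤ.- b) ≡ ι a - ι b
  ι-- a b = trans (ι-+ a (ℤ.- b)) (cong (λ q → ι a + q) (ι-neg b))

  ι-∸ : ∀ {m n} → n ℕ.≤ m → ι (+ (m ∸ n)) ≡ ι (+ m) - ι (+ n)
  ι-∸ {m} {n} n≤m =
    trans (cong ι (trans (sym (ℤP.⊖-≥ n≤m)) (sym (ℤP.m-n≡m⊖n m n)))) (ι-- (+ m) (+ n))

  ι-mono-≤ : ∀ {a b} → a ℤ.≤ b → ι a ≤ ι b
  ι-mono-≤ {a} {b} a≤b = ℚP.toℚᵘ-cancel-≤ (begin
    toℚᵘ (ι a)   ≃⟨ toℚᵘ-ι a ⟩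
    mkℚᵘ a 0     ≤⟨ *≤* (ℤP.*-monoʳ-≤-nonNeg (+ 1) a≤b) ⟩
    mkℚᵘ b 0     ≃⟨ toℚᵘ-ι b ⟨
    toℚᵘ (ι b)   ∎)
    where open ℚᵘP.≤-Reasoning

  ι-pos : ∀ n → ℚ.Positive (ι (+ suc n))
  ι-pos n = ℚP.normalize-pos (suc n) 1

  ι-*-frac : ∀ a d → ι (+ suc d) * frac a (suc d) ≡ ι a
  ι-*-frac a d = ℚP.toℚᵘ-injective (begin
    toℚᵘ (ι (+ suc d) * frac a (suc d))              ≈⟨ ℚP.toℚᵘ-homo-* (ι (+ suc d)) (frac a (suc d)) ⟩
    toℚᵘ (ι (+ suc d)) ℚᵘ.* toℚᵘ (frac a (suc d))   ≈⟨ ℚᵘP.*-cong (toℚᵘ-ι (+ suc d)) (ℚP.toℚᵘ-fromℚᵘ (mkℚᵘ a d)) ⟩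
    mkℚᵘ (+ suc d) 0 ℚᵘ.* mkℚᵘ a d                   ≈⟨ *≡* cross-multiplied ⟩
    mkℚᵘ a 0                                         ≈⟨ toℚᵘ-ι a ⟨
    toℚᵘ (ι a)                                       ∎)
    where
    open ℚᵘP.≃-Reasoning
    cross-multiplied : (+ suc d ℤ.* a) ℤ.* + 1 ≡ a ℤ.* + suc (d ℕ.+ 0)
    cross-multiplied rewrite ℕP.+-identityʳ d = trans (ℤP.*-identityʳ _) (ℤP.*-comm (+ suc d) a)

  frac-≤ : ∀ a d {z} → ι a ≤ ι (+ suc d) * z → frac a (suc d) ≤ z
  frac-≤ a d {z} a≤dz = ℚP.*-cancelˡ-≤-pos (ι (+ suc d)) {{ι-pos d}} (begin
    ι (+ suc d) * frac a (suc d)   ≡⟨ ι-*-frac a d ⟩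
    ι a                            ≤⟨ a≤dz ⟩
    ι (+ suc d) * z                ∎)
    where open ℚP.≤-Reasoning

module Sums where

  open import Data.Rational using (_+_; _-_; _*_)

  open Embedding using (ι-+)

  sumℚ≡∑ : ∀ n f → sumℚ n f ≡ ∑[ i < n ] f i
  sumℚ≡∑ zero    f = refl
  sumℚ≡∑ (suc n) f = cong (λ s → f zero + s) (sumℚ≡∑ n (f ∘ suc))

  ∑-distrib-- : ∀ {n} (f g : Fin n → ℚ) → ∑[ i < n ] (f i - g i) ≡ ∑[ i < n ] f i - ∑[ i < n ] g i
  ∑-distrib-- {zero}  f g = refl
  ∑-distrib-- {suc n} f g =
    trans (cong (λ s → f zero - g zero + s) (∑-distrib-- (f ∘ suc) (g ∘ suc))) (interchange (f zero) (g zero) _ _)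
    where
    interchange : ∀ a b c d → (a - b) + (c - d) ≡ (a + c) - (b + d)
    interchange = solve-∀ ℚ-ring

  ∑-1 : ∀ n → ∑[ j < n ] 1ℚ ≡ ι (+ n)
  ∑-1 zero    = refl
  ∑-1 (suc n) = trans (cong (λ s → 1ℚ + s) (∑-1 n)) (sym (ι-+ (+ 1) (+ n)))

  ∑-sift-e : ∀ {n} k (g : Fin n → ℚ) → ∑[ i < n ] (e i k * g i) ≡ g k
  ∑-sift-e {suc n} zero g = begin
    1ℚ * g zero + ∑[ i < n ] (0ℚ * g (suc i))
      ≡⟨ cong₂ _+_ (ℚP.*-identityˡ (g zero)) (sum-cong-≗ (λ i → ℚP.*-zeroˡ (g (suc i)))) ⟩
    g zero + ∑[ i < n ] 0ℚ
      ≡⟨ cong (λ s → g zero + s) (sum-replicate-zero n) ⟩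
    g zero + 0ℚ
      ≡⟨ ℚP.+-identityʳ (g zero) ⟩
    g zero ∎
    where open ≡-Reasoning
  ∑-sift-e {suc n} (suc k) g =
    trans (cong₂ _+_ (ℚP.*-zeroˡ (g zero)) (∑-sift-e k (g ∘ suc))) (ℚP.+-identityˡ (g (suc k)))

  ∑-sift-e-difference : ∀ {n} (u : Fin n → ℚ) i j → ∑[ t < n ] (u t * (e t i - e t j)) ≡ u i - u j
  ∑-sift-e-difference {n} u i j = begin
    ∑[ t < n ] (u t * (e t i - e t j))                   ≡⟨ sum-cong-≗ {n} (λ t → distribute (u t) (e t i) (e t j)) ⟩
    ∑[ t < n ] (e t i * u t - e t j * u t)               ≡⟨ ∑-distrib-- (λ t → e t i * u t) (λ t → e t j * u t) ⟩
    ∑[ t < n ] (e t i * u t) - ∑[ t < n ] (e t j * u t)  ≡⟨ cong₂ _-_ (∑-sift-e i u) (∑-sift-e j u) ⟩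
    u i - u j                                            ∎
    where
    open ≡-Reasoning
    distribute : ∀ u x y → u * (x - y) ≡ x * u - y * u
    distribute = solve-∀ ℚ-ring

  𝟙 : Bool → ℚ
  𝟙 b = if b then 1ℚ else 0ℚ

  if-then-0≡𝟙* : ∀ b x → (if b then x else 0ℚ) ≡ 𝟙 b * x
  if-then-0≡𝟙* true  x = sym (ℚP.*-identityˡ x)
  if-then-0≡𝟙* false x = sym (ℚP.*-zeroˡ x)

  ∑𝟙[j<k] : ∀ {n} (k : Fin n) → ∑[ j < n ] 𝟙 (does (j <? k)) ≡ ι (+ toℕ k)
  ∑𝟙[j<k] {suc n} zero    = trans (ℚP.+-identityˡ _) (sum-replicate-zero n)
  ∑𝟙[j<k] {suc n} (suc k) = trans (cong (λ s → 1ℚ + s) (∑𝟙[j<k] k)) (sym (ι-+ (+ 1) (+ toℕ k)))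

  ∑𝟙[k<j] : ∀ n (k : Fin (suc n)) → ∑[ j < suc n ] 𝟙 (does (k <? j)) ≡ ι (+ (n ∸ toℕ k))
  ∑𝟙[k<j] n       zero    = trans (ℚP.+-identityˡ _) (∑-1 n)
  ∑𝟙[k<j] (suc n) (suc k) = trans (ℚP.+-identityˡ _) (∑𝟙[k<j] n k)

module Coordinates where

  open import Data.Rational using (_+_; _-_; _*_)

  open Embedding using (ι-*; ι--; ι-∸; ι-*-frac)
  open Sums

  ρΔ-counting : ∀ {n} k → ρΔ n k ≡ ½ * (∑[ j < n ] 𝟙 (does (k <? j)) - ∑[ i < n ] 𝟙 (does (i <? k)))
  ρΔ-counting {n} k = cong (½ *_) (begin
    sumℚ n (λ i → sumℚ n (λ j → if does (i <? j) then e i k - e j k else 0ℚ))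
      ≡⟨ trans (sumℚ≡∑ n _) (sum-cong-≗ {n} λ i → trans (sumℚ≡∑ n _) (sum-cong-≗ λ j →
           trans (if-then-0≡𝟙* (does (i <? j)) _) (distribute (𝟙 (does (i <? j))) (e i k) (e j k)))) ⟩
    ∑[ i < n ] ∑[ j < n ] (e i k * 𝟙 (does (i <? j)) - e j k * 𝟙 (does (i <? j)))
      ≡⟨ sum-cong-≗ (λ i → ∑-distrib-- (λ j → e i k * 𝟙 (does (i <? j))) (λ j → e j k * 𝟙 (does (i <? j)))) ⟩
    ∑[ i < n ] (∑[ j < n ] (e i k * 𝟙 (does (i <? j))) - ∑[ j < n ] (e j k * 𝟙 (does (i <? j))))
      ≡⟨ ∑-distrib-- (λ i → ∑[ j < n ] (e i k * 𝟙 (does (i <? j)))) (λ i → ∑[ j < n ] (e j k * 𝟙 (does (i <? j)))) ⟩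
    ∑[ i < n ] ∑[ j < n ] (e i k * 𝟙 (does (i <? j))) - ∑[ i < n ] ∑[ j < n ] (e j k * 𝟙 (does (i <? j)))
      ≡⟨ cong (_- ∑[ i < n ] ∑[ j < n ] (e j k * 𝟙 (does (i <? j))))
              (sum-cong-≗ {n} λ i → sym (*-distribˡ-sum {n} (e i k) (λ j → 𝟙 (does (i <? j))))) ⟩
    ∑[ i < n ] (e i k * ∑[ j < n ] 𝟙 (does (i <? j))) - ∑[ i < n ] ∑[ j < n ] (e j k * 𝟙 (does (i <? j)))
      ≡⟨ cong (λ s → ∑[ i < n ] (e i k * ∑[ j < n ] 𝟙 (does (i <? j))) - s)
              (sum-cong-≗ {n} λ i → ∑-sift-e k (λ j → 𝟙 (does (i <? j)))) ⟩
    ∑[ i < n ] (e i k * ∑[ j < n ] 𝟙 (does (i <? j))) - ∑[ i < n ] 𝟙 (does (i <? k))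
      ≡⟨ cong (_- ∑[ i < n ] 𝟙 (does (i <? k))) (∑-sift-e k (λ i → ∑[ j < n ] 𝟙 (does (i <? j)))) ⟩
    ∑[ j < n ] 𝟙 (does (k <? j)) - ∑[ i < n ] 𝟙 (does (i <? k)) ∎)
    where
    open ≡-Reasoning
    distribute : ∀ c x y → c * (x - y) ≡ x * c - y * c
    distribute = solve-∀ ℚ-ring

  ρΔ-coordinate : ∀ n k → ρΔ (suc n) k ≡ ½ * ι (+ n) - ι (+ toℕ k)
  ρΔ-coordinate n k = begin
    ρΔ (suc n) k
      ≡⟨ ρΔ-counting k ⟩
    ½ * (∑[ j < suc n ] 𝟙 (does (k <? j)) - ∑[ i < suc n ] 𝟙 (does (i <? k)))
      ≡⟨ cong₂ (λ s t → ½ * (s - t)) (trans (∑𝟙[k<j] n k) (ι-∸ (toℕ≤pred[n] k))) (∑𝟙[j<k] k) ⟩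
    ½ * (ι (+ n) - ι (+ toℕ k) - ι (+ toℕ k))
      ≡⟨ halve ½ (ι (+ n)) (ι (+ toℕ k)) ⟩
    ½ * ι (+ n) - (½ + ½) * ι (+ toℕ k)
      ≡⟨ cong (λ c → ½ * ι (+ n) - c) (ℚP.*-identityˡ _) ⟩
    ½ * ι (+ n) - ι (+ toℕ k) ∎
    where
    open ≡-Reasoning
    halve : ∀ h a b → h * (a - b - b) ≡ h * a - (h + h) * b
    halve = solve-∀ ℚ-ring

  eℤ : ∀ {n} → Fin n → Fin n → ℤ
  eℤ i k = if does (i ≟ k) then + 1 else + 0

  ι-eℤ : ∀ {n} (i k : Fin n) → ι (eℤ i k) ≡ e i k
  ι-eℤ i k with does (i ≟ k)
  ... | true  = refl
  ... | false = refl

  Adual⇒integral-differences : ∀ {n} (v : Vecℚ n) → Adual n v → ∀ i j → ∃[ m ] v i - v j ≡ ι m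
  Adual⇒integral-differences {n} v (_ , integral) i j = map₂ (trans (sym ⟪v,w⟫≡)) (integral w w∈A)
    where
    open ≡-Reasoning
    w : Fin n → ℤ
    w t = eℤ t i ℤ.- eℤ t j
    ι-w : ∀ t → ι (w t) ≡ e t i - e t j
    ι-w t = trans (ι-- (eℤ t i) (eℤ t j)) (cong₂ _-_ (ι-eℤ t i) (ι-eℤ t j))
    w∈A : A n w
    w∈A = begin
      sumℚ n (λ t → ι (w t))                ≡⟨ sumℚ≡∑ n (λ t → ι (w t)) ⟩
      ∑[ t < n ] ι (w t)                    ≡⟨ sum-cong-≗ {n} (λ t → trans (ι-w t) (sym (ℚP.*-identityˡ (e t i - e t j)))) ⟩
      ∑[ t < n ] (1ℚ * (e t i - e t j))     ≡⟨ ∑-sift-e-difference (λ _ → 1ℚ) i j ⟩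
      1ℚ - 1ℚ                               ≡⟨ ℚP.+-inverseʳ 1ℚ ⟩
      0ℚ                                    ∎
    ⟪v,w⟫≡ : ⟪ v , (λ t → ι (w t)) ⟫ ≡ v i - v j
    ⟪v,w⟫≡ = begin
      sumℚ n (λ t → v t * ι (w t))          ≡⟨ sumℚ≡∑ n (λ t → v t * ι (w t)) ⟩
      ∑[ t < n ] (v t * ι (w t))            ≡⟨ sum-cong-≗ {n} (λ t → cong (v t *_) (ι-w t)) ⟩
      ∑[ t < n ] (v t * (e t i - e t j))    ≡⟨ ∑-sift-e-difference v i j ⟩
      v i - v j                             ∎

  scaled-coordinate : ∀ {n} l (v : Vecℚ (suc n)) (m : Fin (suc n) → ℤ) → (∀ k → v k - v zero ≡ ι (m k)) →
    let x = (frac (+ l) (suc n) · ρΔ (suc n)) ⊕ v in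
    ∀ k → ι (+ suc n) * x k ≡ ι (+ suc n) * x zero + ι (+ suc n ℤ.* m k ℤ.- + l ℤ.* + toℕ k)
  scaled-coordinate {n} l v m v-v₀≡m k = begin
    P * (f * ρΔ (suc n) k + v k)
      ≡⟨ cong₂ (λ r w → P * (f * r + w)) (ρΔ-coordinate n k) (split (v k) (v zero)) ⟩
    P * (f * (h - ι (+ toℕ k)) + (v zero + (v k - v zero)))
      ≡⟨ rearrange P f h (ι (+ toℕ k)) (v zero) (v k - v zero) ⟩
    P * (f * (h - 0ℚ) + v zero) + (P * (v k - v zero) - P * f * ι (+ toℕ k))
      ≡⟨ cong₂ (λ μ s → P * (f * (h - 0ℚ) + v zero) + (P * μ - s * ι (+ toℕ k))) (v-v₀≡m k) (ι-*-frac (+ l) n) ⟩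
    P * (f * (h - 0ℚ) + v zero) + (P * ι (m k) - ι (+ l) * ι (+ toℕ k))
      ≡⟨ cong₂ (λ r s → P * (f * r + v zero) + s) (ρΔ-coordinate n zero) ι-affine ⟨
    P * (f * ρΔ (suc n) zero + v zero) + ι (+ suc n ℤ.* m k ℤ.- + l ℤ.* + toℕ k) ∎
    where
    open ≡-Reasoning
    P = ι (+ suc n)
    f = frac (+ l) (suc n)
    h = ½ * ι (+ n)
    ι-affine : ι (+ suc n ℤ.* m k ℤ.- + l ℤ.* + toℕ k) ≡ P * ι (m k) - ι (+ l) * ι (+ toℕ k)
    ι-affine = trans (ι-- (+ suc n ℤ.* m k) (+ l ℤ.* + toℕ k)) (cong₂ _-_ (ι-* (+ suc n) (m k)) (ι-* (+ l) (+ toℕ k)))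
    split : ∀ a b → a ≡ b + (a - b)
    split = solve-∀ ℚ-ring
    rearrange : ∀ P f h t v₀ μ → P * (f * (h - t) + (v₀ + μ)) ≡ P * (f * (h - 0ℚ) + v₀) + (P * μ - P * f * t)
    rearrange = solve-∀ ℚ-ring

module NormBound where

  open import Data.Rational using (_+_; _-_; _*_; _≤_)

  open Dispersion using (dispersion)
  open Embedding using (ι-+; ι-*; ι--; ι-pos; frac-≤)
  open Sums using (sumℚ≡∑)

  0≤p*p : ∀ p → 0ℚ ≤ p * p
  0≤p*p p with ℚP.≤-total 0ℚ p
  ... | inj₁ 0≤p = ℚP.nonNegative⁻¹ _ {{ℚP.nonNeg*nonNeg⇒nonNeg p p}}
    where instance _ = ℚ.nonNegative 0≤p
  ... | inj₂ p≤0 = ℚP.nonNegative⁻¹ _ {{ℚP.nonPos*nonPos⇒nonPos p p}}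
    where instance _ = ℚ.nonPositive p≤0

  ι-∑ : ∀ {n} (a : Fin n → ℤ) → ι (∑ℤ a) ≡ ∑[ k < n ] ι (a k)
  ι-∑ {zero}  a = refl
  ι-∑ {suc n} a = trans (ι-+ (a zero) (∑ℤ (a ∘ suc))) (cong (λ s → ι (a zero) + s) (ι-∑ (a ∘ suc)))

  ι-dispersion : ∀ {n} (a : Fin n → ℤ) →
    ι (dispersion a) ≡ ι (+ n) * ∑[ k < n ] (ι (a k) * ι (a k)) - ∑[ k < n ] ι (a k) * ∑[ k < n ] ι (a k)
  ι-dispersion {n} a = begin
    ι (+ n ℤ.* ∑ℤ (λ k → a k ℤ.* a k) ℤ.- ∑ℤ a ℤ.* ∑ℤ a)
      ≡⟨ ι-- (+ n ℤ.* ∑ℤ (λ k → a k ℤ.* a k)) (∑ℤ a ℤ.* ∑ℤ a) ⟩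
    ι (+ n ℤ.* ∑ℤ (λ k → a k ℤ.* a k)) - ι (∑ℤ a ℤ.* ∑ℤ a)
      ≡⟨ cong₂ _-_ (ι-* (+ n) (∑ℤ (λ k → a k ℤ.* a k))) (ι-* (∑ℤ a) (∑ℤ a)) ⟩
    ι (+ n) * ι (∑ℤ (λ k → a k ℤ.* a k)) - ι (∑ℤ a) * ι (∑ℤ a)
      ≡⟨ cong₂ (λ s t → ι (+ n) * s - t * t)
               (trans (ι-∑ (λ k → a k ℤ.* a k)) (sum-cong-≗ {n} (λ k → ι-* (a k) (a k)))) (ι-∑ a) ⟩
    ι (+ n) * ∑[ k < n ] (ι (a k) * ι (a k)) - ∑[ k < n ] ι (a k) * ∑[ k < n ] ι (a k) ∎
    where open ≡-Reasoning

  ∑-square-add : ∀ {n} c (y : Fin n → ℚ) →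
    ∑[ k < n ] ((c + y k) * (c + y k)) ≡ ι (+ n) * c * c + (c + c) * ∑[ k < n ] y k + ∑[ k < n ] (y k * y k)
  ∑-square-add {zero}  c y = vanish c
    where
    vanish : ∀ c → 0ℚ ≡ 0ℚ * c * c + (c + c) * 0ℚ + 0ℚ
    vanish = solve-∀ ℚ-ring
  ∑-square-add {suc n} c y = begin
    (c + y zero) * (c + y zero) + ∑[ k < n ] ((c + y (suc k)) * (c + y (suc k)))
      ≡⟨ cong (λ s → (c + y zero) * (c + y zero) + s) (∑-square-add c (y ∘ suc)) ⟩
    (c + y zero) * (c + y zero) + (ι (+ n) * c * c + (c + c) * ∑[ k < n ] y (suc k) + ∑[ k < n ] (y (suc k) * y (suc k)))
      ≡⟨ expand (ι (+ n)) c (y zero) (∑[ k < n ] y (suc k)) (∑[ k < n ] (y (suc k) * y (suc k))) ⟩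
    (1ℚ + ι (+ n)) * c * c + (c + c) * ∑[ k < suc n ] y k + ∑[ k < suc n ] (y k * y k)
      ≡⟨ cong (λ N → N * c * c + (c + c) * ∑[ k < suc n ] y k + ∑[ k < suc n ] (y k * y k)) (ι-+ (+ 1) (+ n)) ⟨
    ι (+ suc n) * c * c + (c + c) * ∑[ k < suc n ] y k + ∑[ k < suc n ] (y k * y k) ∎
    where
    open ≡-Reasoning
    expand : ∀ N c b s t → (c + b) * (c + b) + (N * c * c + (c + c) * s + t)
                         ≡ (1ℚ + N) * c * c + (c + c) * (b + s) + (b * b + t)
    expand = solve-∀ ℚ-ring

  dispersion≤shifted-∑-square : ∀ {n} c (a : Fin n → ℤ) →
    ι (dispersion a) ≤ ι (+ n) * ∑[ k < n ] ((c + ι (a k)) * (c + ι (a k)))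
  dispersion≤shifted-∑-square {n} c a = begin
    ι (dispersion a)                               ≡⟨ ι-dispersion a ⟩
    N * T - S * S                                  ≡⟨ ℚP.+-identityˡ _ ⟨
    0ℚ + (N * T - S * S)                           ≤⟨ ℚP.+-monoˡ-≤ (N * T - S * S) (0≤p*p (N * c + S)) ⟩
    (N * c + S) * (N * c + S) + (N * T - S * S)    ≡⟨ complete-square N c S T ⟩
    N * (N * c * c + (c + c) * S + T)              ≡⟨ cong (N *_) (∑-square-add c (λ k → ι (a k))) ⟨
    N * ∑[ k < n ] ((c + ι (a k)) * (c + ι (a k))) ∎
    where
    open ℚP.≤-Reasoning
    N = ι (+ n)
    S = ∑[ k < n ] ι (a k)
    T = ∑[ k < n ] (ι (a k) * ι (a k))
    complete-square : ∀ N c S T → (N * c + S) * (N * c + S) + (N * T - S * S) ≡ N * (N * c * c + (c + c) * S + T)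
    complete-square = solve-∀ ℚ-ring

  ∑-scaled-square : ∀ {n} c (x : Vecℚ n) → ∑[ k < n ] ((c * x k) * (c * x k)) ≡ c * c * ⟪ x , x ⟫
  ∑-scaled-square {n} c x = begin
    ∑[ k < n ] ((c * x k) * (c * x k))   ≡⟨ sum-cong-≗ {n} (λ k → regroup c (x k)) ⟩
    ∑[ k < n ] (c * c * (x k * x k))     ≡⟨ *-distribˡ-sum {n} (c * c) (λ k → x k * x k) ⟨
    c * c * ∑[ k < n ] (x k * x k)       ≡⟨ cong (c * c *_) (sumℚ≡∑ n (λ k → x k * x k)) ⟨
    c * c * ⟪ x , x ⟫                    ∎
    where
    open ≡-Reasoning
    regroup : ∀ c y → (c * y) * (c * y) ≡ c * c * (y * y)
    regroup = solve-∀ ℚ-ring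

  dispersion≤norm : ∀ {n} (x : Vecℚ n) c (a : Fin n → ℤ) → (∀ k → ι (+ n) * x k ≡ c + ι (a k)) →
    ι (dispersion a) ≤ ι (+ n) * (ι (+ n) * ι (+ n) * ⟪ x , x ⟫)
  dispersion≤norm {n} x c a x≡c+a = begin
    ι (dispersion a)                                 ≤⟨ dispersion≤shifted-∑-square c a ⟩
    N * ∑[ k < n ] ((c + ι (a k)) * (c + ι (a k)))   ≡⟨ cong (N *_) (sum-cong-≗ {n} (λ k → cong₂ _*_ (x≡c+a k) (x≡c+a k))) ⟨
    N * ∑[ k < n ] ((N * x k) * (N * x k))           ≡⟨ cong (N *_) (∑-scaled-square N x) ⟩
    N * (N * N * ⟪ x , x ⟫)                          ∎
    where
    open ℚP.≤-Reasoning
    N = ι (+ n)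

  [p-1][p+1]/12p≤ : ∀ n {z} → let P = ι (+ suc n) in
    ι (+ suc n ℤ.* + suc n ℤ.* (+ suc n ℤ.* + suc n ℤ.- + 1)) ≤ ι (+ 12) * (P * (P * P * z)) →
    frac (+ (n ℕ.* (suc n ℕ.+ 1))) (12 ℕ.* suc n) ≤ z
  [p-1][p+1]/12p≤ n {z} bound =
    -- 12 ℕ.* suc n reduces to suc (n ℕ.+ 11 ℕ.* suc n).
    frac-≤ (+ K) (n ℕ.+ 11 ℕ.* suc n) (ℚP.*-cancelˡ-≤-pos (P * P) {{P²>0}} (begin
      P * P * ι (+ K)                                    ≡⟨ ι-p²[p²-1] ⟨
      ι (+ p ℤ.* + p ℤ.* (+ p ℤ.* + p ℤ.- + 1))          ≤⟨ bound ⟩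
      ι (+ 12) * (P * (P * P * z))                       ≡⟨ regroup (ι (+ 12)) P z ⟩
      P * P * (ι (+ 12) * P * z)                         ≡⟨ cong (λ c → P * P * (c * z)) ι[12p] ⟨
      P * P * (ι (+ (12 ℕ.* p)) * z)                     ∎))
    where
    open ℚP.≤-Reasoning
    p = suc n
    P = ι (+ p)
    K = n ℕ.* (suc n ℕ.+ 1)
    P²>0 : ℚ.Positive (P * P)
    P²>0 = ℚP.pos*pos⇒pos P {{ι-pos n}} P {{ι-pos n}}
    factor : ∀ N → (+ 1 ℤ.+ N) ℤ.* (+ 1 ℤ.+ N) ℤ.- + 1 ≡ N ℤ.* ((+ 1 ℤ.+ N) ℤ.+ + 1)
    factor = solve-∀ ℤ-ring
    p²-1≡K : + p ℤ.* + p ℤ.- + 1 ≡ + K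
    p²-1≡K = trans (factor (+ n)) (sym (trans (ℤP.pos-* n (suc n ℕ.+ 1)) (cong (+ n ℤ.*_) (ℤP.pos-+ (suc n) 1))))
    ι-p²[p²-1] : ι (+ p ℤ.* + p ℤ.* (+ p ℤ.* + p ℤ.- + 1)) ≡ P * P * ι (+ K)
    ι-p²[p²-1] = trans (cong (λ t → ι (+ p ℤ.* + p ℤ.* t)) p²-1≡K)
      (trans (ι-* (+ p ℤ.* + p) (+ K)) (cong (_* ι (+ K)) (ι-* (+ p) (+ p))))
    ι[12p] : ι (+ (12 ℕ.* p)) ≡ ι (+ 12) * P
    ι[12p] = trans (cong ι (ℤP.pos-* 12 p)) (ι-* (+ 12) (+ p))
    regroup : ∀ t P z → t * (P * (P * P * z)) ≡ P * P * (t * P * z)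
    regroup = solve-∀ ℚ-ring

open Dispersion using (dispersion; injective⇒dispersion-bound)
open AffineInjectivity using (affine-injective)
open Embedding using (ι-*; ι-mono-≤)
open Coordinates using (Adual⇒integral-differences; scaled-coordinate)
open NormBound using (dispersion≤norm; [p-1][p+1]/12p≤)

open import Data.Nat using (_≤_; _*_; _+_)
open import Data.Rational using () renaming (_≤_ to _≤ℚ_)

lemma2p7 : (p : ℕ) → Prime p → p ≢ 2 → (l : ℕ) → 1 ≤ l → l ≤ p ∸ 1 →
    (v : Vecℚ p) → Adual p v →
    let x = (frac (+ l) p · ρΔ p) ⊕ v in
    frac (+ ((p ∸ 1) * (p + 1))) (12 * p) ≤ℚ ⟪ x , x ⟫
lemma2p7 zero    p-prime = contradiction p-prime ¬prime[0]
lemma2p7 (suc n) p-prime _ l 1≤l l≤n v v∈A* = [p-1][p+1]/12p≤ n (begin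
  ι (+ p ℤ.* + p ℤ.* (+ p ℤ.* + p ℤ.- + 1))
    ≤⟨ ι-mono-≤ (injective⇒dispersion-bound a (affine-injective p-prime l≤n m)) ⟩
  ι (+ 12 ℤ.* dispersion a)
    ≡⟨ ι-* (+ 12) (dispersion a) ⟩
  ι (+ 12) ℚ.* ι (dispersion a)
    ≤⟨ ℚP.*-monoˡ-≤-nonNeg (ι (+ 12)) (dispersion≤norm x (P ℚ.* x zero) a (scaled-coordinate l v m v-v₀≡m)) ⟩
  ι (+ 12) ℚ.* (P ℚ.* (P ℚ.* P ℚ.* ⟪ x , x ⟫)) ∎)
  where
  open ℚP.≤-Reasoning
  instance
    l≢0 : NonZero l
    l≢0 = ℕ.>-nonZero 1≤l
  p = suc n
  P = ι (+ p)
  x = (frac (+ l) p · ρΔ p) ⊕ v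
  m : Fin p → ℤ
  m k = proj₁ (Adual⇒integral-differences v v∈A* k zero)
  v-v₀≡m : ∀ k → v k ℚ.- v zero ≡ ι (m k)
  v-v₀≡m k = proj₂ (Adual⇒integral-differences v v∈A* k zero)
  a : Fin p → ℤ
  a k = + p ℤ.* m k ℤ.- + l ℤ.* + toℕ k
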